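{- Let $A_1$ and $A_2$ be connected simple graphs of order $n>2$, with the same label on the edges of both graphs, and let $B_1,B_2$ be their binding graphs, with binding edges carrying that same label. Then: (1) $A_1\cong A_2$ if and only if $B_1\cong B_2$; (2) $\mathrm{Aut}(A_1)\cong\mathrm{Aut}(B_1)$; (3) no basic vertex of $B_1$ lies in the same $\mathrm{Aut}(B_1)$-orbit as a binding vertex; (4) the $\mathrm{Aut}(B_1)$-orbits consisting of basic vertices are exactly the $\mathrm{Aut}(A_1)$-orbits.
   Context: Labels are indeterminates $x_0,x_1,\dots$. A graph of order $N$ is a symmetric $N\times N$ matrix $(g_{ij})$ with entries among these labels; $j$ is a neighbour of $i$ iff $i\ne j$ and $g_{ij}\ne x_0$. A simple graph has all diagonal entries $x_0$ and at most two distinct entries (so all edges carry one label). Two graphs $A,B$ of order $N$ are isomorphic ($A\cong B$) if there is a permutation $\sigma$ of $[N]$ with $a_{i^\sigma j^\sigma}=b_{ij}$ for all $i,j$; automorphisms are isomorphisms of a graph to itself. The binding graph $B$ of a simple graph $A$ on $[n]$ is the simple graph on $[n_1]$, $n_1=n(n+1)/2$, whose subgraph induced on $[n]$ is $A$ and in which, for each pair of distinct $u,v\in[n]$, there is a unique vertex $p=u\dot\wedge v\in\{n+1,\dots,n_1\}$ adjacent exactly to $u$ and $v$ (the edges $(u,p),(v,p)$ are binding edges). Vertices in $[n]$ are basic, the others binding vertices. -}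

module Defs where

open import Data.Nat using (ℕ; zero; suc; _+_; _*_; _≤_; _<_)
open import Data.Nat.DivMod using (_/_)
open import Data.Fin using (Fin; toℕ; fromℕ<)
open import Data.Fin.Permutation using (Permutation′; _⟨$⟩ʳ_; _∘ₚ_)
open import Data.Product using (Σ; ∃; ∃-syntax; _×_; _,_; proj₁; proj₂)
open import Data.Sum using (_⊎_)
open import Relation.Nullary using (¬_)
open import Relation.Binary.PropositionalEquality using (_≡_; _≢_; trans)

-- Labels x₀, x₁, … are represented by natural numbers: label xₖ is k.
-- A graph of order N: an N×N matrix of labels (symmetry is part of
-- the simple-graph predicate below).
Graph : ℕ → Set
Graph N = Fin N → Fin N → ℕ

Symmetric : ∀ {N} → Graph N → Set
Symmetric {N} A = ∀ (i j : Fin N) → A i j ≡ A j i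

Adjacent : ∀ {N} → Graph N → Fin N → Fin N → Set
Adjacent A i j = (i ≢ j) × (A i j ≢ 0)

SimpleWith : ∀ {N} → ℕ → Graph N → Set
SimpleWith {N} ℓ A =
  Symmetric A × (∀ (i : Fin N) → A i i ≡ 0) × (∀ (i j : Fin N) → (A i j ≡ 0) ⊎ (A i j ≡ ℓ))

data Reachable {N} (A : Graph N) : Fin N → Fin N → Set where
  here  : ∀ {i} → Reachable A i i
  step  : ∀ {i j k} → Adjacent A i j → Reachable A j k → Reachable A i k

Connected : ∀ {N} → Graph N → Set
Connected {N} A = ∀ (i j : Fin N) → Reachable A i j

_≅_ : ∀ {N} → Graph N → Graph N → Set
_≅_ {N} A B = Σ (Permutation′ N) λ σ → ∀ (i j : Fin N) → A (σ ⟨$⟩ʳ i) (σ ⟨$⟩ʳ j) ≡ B i j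

IsAut : ∀ {N} → Graph N → Permutation′ N → Set
IsAut {N} A σ = ∀ (i j : Fin N) → A (σ ⟨$⟩ʳ i) (σ ⟨$⟩ʳ j) ≡ A i j

Aut : ∀ {N} → Graph N → Set
Aut {N} A = Σ (Permutation′ N) (IsAut A)

_≈ᴬ_ : ∀ {N} {A : Graph N} → Aut A → Aut A → Set
_≈ᴬ_ {N} σ τ = ∀ (i : Fin N) → proj₁ σ ⟨$⟩ʳ i ≡ proj₁ τ ⟨$⟩ʳ i

-- composition (right action: i^(στ) = (i^σ)^τ)
_·ᴬ_ : ∀ {N} {A : Graph N} → Aut A → Aut A → Aut A
_·ᴬ_ {A = A} (σ , p) (τ , q) = (σ ∘ₚ τ) , λ i j → trans (q (σ ⟨$⟩ʳ i) (σ ⟨$⟩ʳ j)) (p i j)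

record AutIso {N M} (A : Graph N) (B : Graph M) : Set where
  field
    to      : Aut A → Aut B
    from    : Aut B → Aut A
    to-cong   : ∀ {σ τ} → σ ≈ᴬ τ → to σ ≈ᴬ to τ
    from-cong : ∀ {σ τ} → σ ≈ᴬ τ → from σ ≈ᴬ from τ
    to-hom  : ∀ (σ τ : Aut A) → to (σ ·ᴬ τ) ≈ᴬ (to σ ·ᴬ to τ)
    from∘to : ∀ (σ : Aut A) → from (to σ) ≈ᴬ σ
    to∘from : ∀ (τ : Aut B) → to (from τ) ≈ᴬ τ

SameOrbit : ∀ {N} → Graph N → Fin N → Fin N → Set
SameOrbit A i j = ∃[ σ ] (IsAut A σ × (σ ⟨$⟩ʳ i ≡ j))

-- n₁ = n(n+1)/2; vertices with toℕ < n are basic (the copy of [n]),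
-- the others are binding vertices.
n₁ : ℕ → ℕ
n₁ n = (n * suc n) / 2

IsBindingGraph : ∀ {n} → ℕ → Graph n → Graph (n₁ n) → Set
IsBindingGraph {n} ℓ A B =
  SimpleWith ℓ B
  × (∀ (i j : Fin (n₁ n)) (hi : toℕ i < n) (hj : toℕ j < n) →
       B i j ≡ A (fromℕ< hi) (fromℕ< hj))
  × (∀ (u v : Fin n) → u ≢ v →
       ∃[ p ] ((n ≤ toℕ p)
               × (∀ (j : Fin (n₁ n)) →
                    (Adjacent B p j → (toℕ j ≡ toℕ u) ⊎ (toℕ j ≡ toℕ v))
                    × ((toℕ j ≡ toℕ u) ⊎ (toℕ j ≡ toℕ v) → Adjacent B p j))
               × (∀ (q : Fin (n₁ n)) → n ≤ toℕ q →
                    (∀ (j : Fin (n₁ n)) →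
                      (Adjacent B q j → (toℕ j ≡ toℕ u) ⊎ (toℕ j ≡ toℕ v))
                      × ((toℕ j ≡ toℕ u) ⊎ (toℕ j ≡ toℕ v) → Adjacent B q j)) →
                    q ≡ p)))

-- The n basic vertices and the n(n-1)/2 binding vertices u ∧̇ v of a binding
-- graph are pairwise distinct, so by counting they are all of its n(n+1)/2
-- vertices. When A is connected and n > 2, a basic vertex u has at least three
-- neighbours (u ∧̇ v, u ∧̇ w and a neighbour of u in A), whereas a binding vertex
-- has exactly two. Hence isomorphisms of binding graphs map basic vertices to
-- basic vertices, restrict to isomorphisms of the underlying graphs, and map
-- u ∧̇ v to the binding vertex of the images of u and v. Conversely every
-- isomorphism π of the underlying graphs extends by u ∧̇ v ↦ π u ∧̇ π v, and
-- restriction and extension are mutually inverse group homomorphisms.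
module Submission where

open import Defs
open import Data.Bool using (if_then_else_; _∨_)
open import Data.Nat using (ℕ; zero; suc; _+_; _*_; _≤_; _<_; z≤n; s≤s)
import Data.Nat.Properties as ℕ
open import Data.Nat.DivMod using (_/_; m*n/n≡m)
open import Data.Fin using (Fin; zero; suc; toℕ; fromℕ<; fromℕ; inject₁; inject≤; splitAt; join; cast; punchOut)
import Data.Fin.Properties as Fin
open import Data.Fin.Permutation using (Permutation′; _⟨$⟩ʳ_; _⟨$⟩ˡ_; _∘ₚ_; flip; permutation; inverseˡ; inverseʳ)
open import Data.Product using (∃; ∃₂; _×_; _,_; proj₁; proj₂)
open import Data.Product.Properties using (×-≡,≡←≡)
open import Data.Sum as Sum using (_⊎_; inj₁; inj₂; [_,_])
open import Data.Empty using (⊥-elim)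
open import Relation.Nullary using (¬_; yes; no; does)
open import Relation.Binary.PropositionalEquality
  using (_≡_; _≢_; refl; sym; trans; cong; cong₂; subst; subst₂; module ≡-Reasoning)
open import Function using (_∘_; id)
open import Function.Bundles using (_⇔_; mk⇔)
open import Function.Definitions using (Injective)

triangle : ℕ → ℕ
triangle zero    = zero
triangle (suc m) = suc m + triangle m

triangle*2≡m*[1+m] : ∀ m → triangle m * 2 ≡ m * suc m
triangle*2≡m*[1+m] zero    = refl
triangle*2≡m*[1+m] (suc m) = begin
  (suc m + triangle m) * 2      ≡⟨ ℕ.*-distribʳ-+ 2 (suc m) (triangle m) ⟩
  suc m * 2 + triangle m * 2    ≡⟨ cong (suc m * 2 +_) (triangle*2≡m*[1+m] m) ⟩
  suc m * 2 + m * suc m         ≡⟨ cong (_+ m * suc m) (ℕ.*-comm (suc m) 2) ⟩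
  2 * suc m + m * suc m         ≡⟨ ℕ.*-distribʳ-+ (suc m) 2 m ⟨
  (2 + m) * suc m               ≡⟨ ℕ.*-comm (2 + m) (suc m) ⟩
  suc m * suc (suc m)           ∎
  where open ≡-Reasoning

n₁≡triangle : ∀ m → n₁ m ≡ triangle m
n₁≡triangle m = trans (cong (_/ 2) (sym (triangle*2≡m*[1+m] m))) (m*n/n≡m (triangle m) 2)

m≤triangle : ∀ m → m ≤ triangle m
m≤triangle zero    = z≤n
m≤triangle (suc m) = ℕ.m≤m+n (suc m) (triangle m)

m≤n₁ : ∀ m → m ≤ n₁ m
m≤n₁ m = subst (m ≤_) (sym (n₁≡triangle m)) (m≤triangle m)

injective⇒surjective : ∀ {m} {f : Fin m → Fin m} → Injective _≡_ _≡_ f → ∀ y → ∃ λ x → f x ≡ y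
injective⇒surjective {zero}      _     ()
injective⇒surjective {suc m} {f} f-inj y with Fin.any? (λ x → f x Fin.≟ y)
... | yes hit  = hit
... | no  miss = ⊥-elim (ℕ.<-irrefl refl (Fin.injective⇒≤ g-inj))
  where
  y≢f : ∀ x → y ≢ f x
  y≢f x y≡fx = miss (x , sym y≡fx)

  g : Fin (suc m) → Fin m
  g x = punchOut (y≢f x)

  g-inj : Injective _≡_ _≡_ g
  g-inj e = f-inj (Fin.punchOut-injective (y≢f _) (y≢f _) e)

-- Fin (triangle m) enumerates the pairs (a , b) with a ≤ b < m; the first
-- suc m elements of Fin (triangle (suc m)) are the pairs (i , m).
pairOf  : ∀ m → Fin (triangle m) → Fin m × Fin m
pairOf⊎ : ∀ m → Fin (suc m) ⊎ Fin (triangle m) → Fin (suc m) × Fin (suc m)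
pairOf zero    ()
pairOf (suc m) x = pairOf⊎ m (splitAt (suc m) x)
pairOf⊎ m (inj₁ i) = i , fromℕ m
pairOf⊎ m (inj₂ y) = inject₁ (proj₁ (pairOf m y)) , inject₁ (proj₂ (pairOf m y))

pairOf-≤  : ∀ m x → toℕ (proj₁ (pairOf m x)) ≤ toℕ (proj₂ (pairOf m x))
pairOf⊎-≤ : ∀ m s → toℕ (proj₁ (pairOf⊎ m s)) ≤ toℕ (proj₂ (pairOf⊎ m s))
pairOf-≤ zero    ()
pairOf-≤ (suc m) x = pairOf⊎-≤ m (splitAt (suc m) x)
pairOf⊎-≤ m (inj₁ i) = subst (toℕ i ≤_) (sym (Fin.toℕ-fromℕ m)) (ℕ.≤-pred (Fin.toℕ<n i))
pairOf⊎-≤ m (inj₂ y) = subst₂ _≤_ (sym (Fin.toℕ-inject₁ _)) (sym (Fin.toℕ-inject₁ _)) (pairOf-≤ m y)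

pairOf-injective  : ∀ m → Injective _≡_ _≡_ (pairOf m)
pairOf⊎-injective : ∀ m → Injective _≡_ _≡_ (pairOf⊎ m)
pairOf-injective zero {()}
pairOf-injective (suc m) {x} {y} e = begin
  x                                           ≡⟨ Fin.join-splitAt (suc m) (triangle m) x ⟨
  join (suc m) (triangle m) (splitAt (suc m) x) ≡⟨ cong (join (suc m) (triangle m)) (pairOf⊎-injective m e) ⟩
  join (suc m) (triangle m) (splitAt (suc m) y) ≡⟨ Fin.join-splitAt (suc m) (triangle m) y ⟩
  y                                           ∎
  where open ≡-Reasoning
pairOf⊎-injective m {inj₁ i} {inj₁ j} e = cong inj₁ (proj₁ (×-≡,≡←≡ e))
pairOf⊎-injective m {inj₁ i} {inj₂ y} e =
  ⊥-elim (Fin.toℕ-inject₁-≢ (proj₂ (pairOf m y)) (trans (sym (Fin.toℕ-fromℕ m)) (cong toℕ (proj₂ (×-≡,≡←≡ e)))))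
pairOf⊎-injective m {inj₂ x} {inj₁ j} e =
  ⊥-elim (Fin.toℕ-inject₁-≢ (proj₂ (pairOf m x)) (trans (sym (Fin.toℕ-fromℕ m)) (cong toℕ (sym (proj₂ (×-≡,≡←≡ e))))))
pairOf⊎-injective m {inj₂ x} {inj₂ y} e with ×-≡,≡←≡ e
... | e₁ , e₂ = cong inj₂ (pairOf-injective m (cong₂ _,_ (Fin.inject₁-injective e₁) (Fin.inject₁-injective e₂)))

twoOthers : ∀ {n} → 2 < n → (u : Fin n) → ∃₂ λ v w → u ≢ v × u ≢ w × v ≢ w
twoOthers (s≤s (s≤s (s≤s z≤n))) zero             = suc zero , suc (suc zero) , (λ ()) , (λ ()) , (λ ())
twoOthers (s≤s (s≤s (s≤s z≤n))) (suc zero)       = zero , suc (suc zero) , (λ ()) , (λ ()) , (λ ())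
twoOthers (s≤s (s≤s (s≤s z≤n))) (suc (suc u))    = zero , suc zero , (λ ()) , (λ ()) , (λ ())

module _ {A : Set} where

  OneOf : A → A → A → Set
  OneOf x a b = x ≡ a ⊎ x ≡ b

  SamePair : A → A → A → A → Set
  SamePair u v u′ v′ = (u ≡ u′ × v ≡ v′) ⊎ (u ≡ v′ × v ≡ u′)

  oneOf⇒samePair : ∀ {x y a b} → OneOf x a b → OneOf y a b → x ≢ y → SamePair x y a b
  oneOf⇒samePair (inj₁ x≡a) (inj₁ y≡a) x≢y = ⊥-elim (x≢y (trans x≡a (sym y≡a)))
  oneOf⇒samePair (inj₁ x≡a) (inj₂ y≡b) x≢y = inj₁ (x≡a , y≡b)
  oneOf⇒samePair (inj₂ x≡b) (inj₁ y≡a) x≢y = inj₂ (x≡b , y≡a)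
  oneOf⇒samePair (inj₂ x≡b) (inj₂ y≡b) x≢y = ⊥-elim (x≢y (trans x≡b (sym y≡b)))

  ¬oneOf-three : ∀ {x y z a b} → x ≢ y → x ≢ z → y ≢ z →
                 OneOf x a b → OneOf y a b → ¬ OneOf z a b
  ¬oneOf-three x≢y x≢z y≢z ox oy oz with oneOf⇒samePair ox oy x≢y | oz
  ... | inj₁ (x≡a , _) | inj₁ z≡a = x≢z (trans x≡a (sym z≡a))
  ... | inj₁ (_ , y≡b) | inj₂ z≡b = y≢z (trans y≡b (sym z≡b))
  ... | inj₂ (x≡b , _) | inj₂ z≡b = x≢z (trans x≡b (sym z≡b))
  ... | inj₂ (_ , y≡a) | inj₁ z≡a = y≢z (trans y≡a (sym z≡a))

samePair-map : ∀ {A B : Set} (f : A → B) {u v u′ v′} →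
               SamePair u v u′ v′ → SamePair (f u) (f v) (f u′) (f v′)
samePair-map f (inj₁ (e₁ , e₂)) = inj₁ (cong f e₁ , cong f e₂)
samePair-map f (inj₂ (e₁ , e₂)) = inj₂ (cong f e₁ , cong f e₂)

does-≟-injective : ∀ {m n} {f : Fin m → Fin n} → Injective _≡_ _≡_ f →
                   ∀ x y → does (f x Fin.≟ f y) ≡ does (x Fin.≟ y)
does-≟-injective {f = f} f-inj x y with x Fin.≟ y | f x Fin.≟ f y
... | yes refl | yes _   = refl
... | yes refl | no fx≢fx = ⊥-elim (fx≢fx refl)
... | no x≢y   | yes fx≡fy = ⊥-elim (x≢y (f-inj fx≡fy))
... | no _     | no _     = refl

incidence : ∀ {n} → ℕ → Fin n → Fin n → Fin n → ℕ
incidence ℓ w u v = if does (w Fin.≟ u) ∨ does (w Fin.≟ v) then ℓ else 0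

incidence-injective : ∀ {m n ℓ} {f : Fin m → Fin n} → Injective _≡_ _≡_ f →
                      ∀ w u v → incidence ℓ (f w) (f u) (f v) ≡ incidence ℓ w u v
incidence-injective {ℓ = ℓ} f-inj w u v =
  cong₂ (λ s t → if s ∨ t then ℓ else 0) (does-≟-injective f-inj w u) (does-≟-injective f-inj w v)

IsIso : ∀ {N} → Graph N → Graph N → Permutation′ N → Set
IsIso {N} G H τ = ∀ (i j : Fin N) → G (τ ⟨$⟩ʳ i) (τ ⟨$⟩ʳ j) ≡ H i j

⟨$⟩ʳ-injective : ∀ {N} (τ : Permutation′ N) → Injective _≡_ _≡_ (τ ⟨$⟩ʳ_)
⟨$⟩ʳ-injective τ e = trans (sym (inverseˡ τ)) (trans (cong (τ ⟨$⟩ˡ_) e) (inverseˡ τ))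

record ThreeNeighbours {N} (G : Graph N) (i : Fin N) : Set where
  field
    j₁ j₂ j₃  : Fin N
    j₁≢j₂     : j₁ ≢ j₂
    j₁≢j₃     : j₁ ≢ j₃
    j₂≢j₃     : j₂ ≢ j₃
    adjacent₁ : Adjacent G i j₁
    adjacent₂ : Adjacent G i j₂
    adjacent₃ : Adjacent G i j₃

module _ {N} {G H : Graph N} {τ : Permutation′ N} (iso : IsIso G H τ) where

  isIso-flip : IsIso H G (flip τ)
  isIso-flip i j = trans (sym (iso _ _)) (cong₂ G (inverseʳ τ) (inverseʳ τ))

  adjacent-iso : ∀ {i j} → Adjacent H i j → Adjacent G (τ ⟨$⟩ʳ i) (τ ⟨$⟩ʳ j)
  adjacent-iso (i≢j , Hij≢0) = i≢j ∘ ⟨$⟩ʳ-injective τ , Hij≢0 ∘ trans (sym (iso _ _))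

  threeNeighbours-iso : ∀ {i} → ThreeNeighbours H i → ThreeNeighbours G (τ ⟨$⟩ʳ i)
  threeNeighbours-iso t = record
    { j₁ = τ ⟨$⟩ʳ j₁ ; j₂ = τ ⟨$⟩ʳ j₂ ; j₃ = τ ⟨$⟩ʳ j₃
    ; j₁≢j₂ = j₁≢j₂ ∘ ⟨$⟩ʳ-injective τ
    ; j₁≢j₃ = j₁≢j₃ ∘ ⟨$⟩ʳ-injective τ
    ; j₂≢j₃ = j₂≢j₃ ∘ ⟨$⟩ʳ-injective τ
    ; adjacent₁ = adjacent-iso adjacent₁
    ; adjacent₂ = adjacent-iso adjacent₂
    ; adjacent₃ = adjacent-iso adjacent₃
    }
    where open ThreeNeighbours t

reachable⇒neighbour : ∀ {N} {G : Graph N} {i j} → i ≢ j → Reachable G i j → ∃ λ k → Adjacent G i k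
reachable⇒neighbour i≢i here                  = ⊥-elim (i≢i refl)
reachable⇒neighbour _   (step {j = k} i~k _) = k , i~k

module _ {N ℓ} {G : Graph N} (simple : SimpleWith ℓ G) where

  adjacent-sym : ∀ {i j} → Adjacent G i j → Adjacent G j i
  adjacent-sym {i} {j} (i≢j , Gij≢0) = i≢j ∘ sym , Gij≢0 ∘ trans (proj₁ simple i j)

  adjacent⇒≡ℓ : ∀ {i j} → Adjacent G i j → G i j ≡ ℓ
  adjacent⇒≡ℓ {i} {j} (_ , Gij≢0) = [ ⊥-elim ∘ Gij≢0 , id ] (proj₂ (proj₂ simple) i j)

  ¬adjacent⇒≡0 : ∀ {i j} → ¬ Adjacent G i j → G i j ≡ 0
  ¬adjacent⇒≡0 {i} {j} ¬i~j with i Fin.≟ j | G i j ℕ.≟ 0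
  ... | yes refl | _         = proj₁ (proj₂ simple) i
  ... | no _     | yes Gij≡0 = Gij≡0
  ... | no i≢j   | no Gij≢0  = ⊥-elim (¬i~j (i≢j , Gij≢0))

restrictₚ : ∀ {n N} {ι : Fin n → Fin N} → Injective _≡_ _≡_ ι → (τ : Permutation′ N) →
            (∀ u → ∃ λ x → τ ⟨$⟩ʳ ι u ≡ ι x) → (∀ u → ∃ λ x → τ ⟨$⟩ˡ ι u ≡ ι x) → Permutation′ n
restrictₚ {ι = ι} ι-inj τ to from = permutation (proj₁ ∘ to) (proj₁ ∘ from) to∘from from∘to
  where
  to∘from : ∀ u → proj₁ (to (proj₁ (from u))) ≡ u
  to∘from u = ι-inj (begin
    ι (proj₁ (to (proj₁ (from u))))  ≡⟨ proj₂ (to _) ⟨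
    τ ⟨$⟩ʳ ι (proj₁ (from u))        ≡⟨ cong (τ ⟨$⟩ʳ_) (proj₂ (from u)) ⟨
    τ ⟨$⟩ʳ (τ ⟨$⟩ˡ ι u)               ≡⟨ inverseʳ τ ⟩
    ι u                              ∎)
    where open ≡-Reasoning
  from∘to : ∀ u → proj₁ (from (proj₁ (to u))) ≡ u
  from∘to u = ι-inj (begin
    ι (proj₁ (from (proj₁ (to u))))  ≡⟨ proj₂ (from _) ⟨
    τ ⟨$⟩ˡ ι (proj₁ (to u))          ≡⟨ cong (τ ⟨$⟩ˡ_) (proj₂ (to u)) ⟨
    τ ⟨$⟩ˡ (τ ⟨$⟩ʳ ι u)               ≡⟨ inverseˡ τ ⟩
    ι u                              ∎)
    where open ≡-Reasoning

basic : ∀ {n} → Fin n → Fin (n₁ n)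
basic {n} u = inject≤ u (m≤n₁ n)

toℕ-basic : ∀ {n} (u : Fin n) → toℕ (basic u) ≡ toℕ u
toℕ-basic u = Fin.toℕ-inject≤ u _

basic<n : ∀ {n} (u : Fin n) → toℕ (basic u) < n
basic<n u = subst (_< _) (sym (toℕ-basic u)) (Fin.toℕ<n u)

basic-injective : ∀ {n} → Injective _≡_ _≡_ (basic {n})
basic-injective {x = u} {v} e = Fin.toℕ-injective (trans (sym (toℕ-basic u)) (trans (cong toℕ e) (toℕ-basic v)))

basic-fromℕ< : ∀ {n} {i : Fin (n₁ n)} (i<n : toℕ i < n) → basic (fromℕ< i<n) ≡ i
basic-fromℕ< i<n = Fin.toℕ-injective (trans (toℕ-basic _) (Fin.toℕ-fromℕ< i<n))

module BindingGraph {n ℓ : ℕ} {A : Graph n} {B : Graph (n₁ n)} (bind : IsBindingGraph ℓ A B) where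

  simple : SimpleWith ℓ B
  simple = proj₁ bind

  B-basic : ∀ u v → B (basic u) (basic v) ≡ A u v
  B-basic u v = trans (proj₁ (proj₂ bind) (basic u) (basic v) (basic<n u) (basic<n v))
                      (cong₂ A (basic-injective (basic-fromℕ< (basic<n u)))
                               (basic-injective (basic-fromℕ< (basic<n v))))

  adjacent-basic : ∀ {u v} → Adjacent A u v → Adjacent B (basic u) (basic v)
  adjacent-basic {u} {v} (u≢v , Auv≢0) = u≢v ∘ basic-injective , Auv≢0 ∘ trans (sym (B-basic u v))

  Binds : Fin (n₁ n) → Fin n → Fin n → Set
  Binds p u v = ∀ j → (Adjacent B p j → OneOf (toℕ j) (toℕ u) (toℕ v))
                    × (OneOf (toℕ j) (toℕ u) (toℕ v) → Adjacent B p j)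

  binder : (u v : Fin n) → u ≢ v → Fin (n₁ n)
  binder u v u≢v = proj₁ (proj₂ (proj₂ bind) u v u≢v)

  module _ {u v : Fin n} {u≢v : u ≢ v} where

    n≤binder : n ≤ toℕ (binder u v u≢v)
    n≤binder = proj₁ (proj₂ (proj₂ (proj₂ bind) u v u≢v))

    binder-binds : Binds (binder u v u≢v) u v
    binder-binds = proj₁ (proj₂ (proj₂ (proj₂ (proj₂ bind) u v u≢v)))

    binder-unique : ∀ {q} → n ≤ toℕ q → Binds q u v → q ≡ binder u v u≢v
    binder-unique = proj₂ (proj₂ (proj₂ (proj₂ (proj₂ bind) u v u≢v))) _

    binder-adjacent : ∀ {w} → OneOf w u v → Adjacent B (binder u v u≢v) (basic w)
    binder-adjacent {w} w∈uv =
      proj₂ (binder-binds (basic w)) (Sum.map (λ e → trans (toℕ-basic w) (cong toℕ e))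
                                              (λ e → trans (toℕ-basic w) (cong toℕ e)) w∈uv)

    adjacent-binder⇒oneOf : ∀ {w} → Adjacent B (binder u v u≢v) (basic w) → OneOf w u v
    adjacent-binder⇒oneOf {w} p~w =
      Sum.map (λ e → Fin.toℕ-injective (trans (sym (toℕ-basic w)) e))
              (λ e → Fin.toℕ-injective (trans (sym (toℕ-basic w)) e)) (proj₁ (binder-binds (basic w)) p~w)

    adjacent-binder⇒<n : ∀ {j} → Adjacent B (binder u v u≢v) j → toℕ j < n
    adjacent-binder⇒<n {j} p~j = [ (λ e → subst (_< n) (sym e) (Fin.toℕ<n u))
                                 , (λ e → subst (_< n) (sym e) (Fin.toℕ<n v)) ] (proj₁ (binder-binds j) p~j)

    basic≢binder : ∀ {w} → basic w ≢ binder u v u≢v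
    basic≢binder {w} e = ℕ.<⇒≱ (basic<n w) (subst (λ q → n ≤ toℕ q) (sym e) n≤binder)

    ¬threeNeighbours-binder : ¬ ThreeNeighbours B (binder u v u≢v)
    ¬threeNeighbours-binder t =
      ¬oneOf-three (j₁≢j₂ ∘ Fin.toℕ-injective) (j₁≢j₃ ∘ Fin.toℕ-injective) (j₂≢j₃ ∘ Fin.toℕ-injective)
                   (proj₁ (binder-binds j₁) adjacent₁) (proj₁ (binder-binds j₂) adjacent₂)
                   (proj₁ (binder-binds j₃) adjacent₃)
      where open ThreeNeighbours t

  binder-cong : ∀ {u v u′ v′ u≢v u′≢v′} → SamePair u v u′ v′ → binder u v u≢v ≡ binder u′ v′ u′≢v′
  binder-cong (inj₁ (refl , refl)) = binder-unique n≤binder binder-binds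
  binder-cong (inj₂ (refl , refl)) =
    binder-unique n≤binder (λ j → Sum.swap ∘ proj₁ (binder-binds j) , proj₂ (binder-binds j) ∘ Sum.swap)

  binder-injective : ∀ {u v u′ v′ u≢v u′≢v′} → binder u v u≢v ≡ binder u′ v′ u′≢v′ → SamePair u v u′ v′
  binder-injective {u≢v = u≢v} e =
    oneOf⇒samePair (adjacent-binder⇒oneOf (subst (λ p → Adjacent B p _) e (binder-adjacent (inj₁ refl))))
                   (adjacent-binder⇒oneOf (subst (λ p → Adjacent B p _) e (binder-adjacent (inj₂ refl))))
                   u≢v

  B-basic-binder : ∀ {w u v u≢v} → B (basic w) (binder u v u≢v) ≡ incidence ℓ w u v
  B-basic-binder {w} {u} {v} with w Fin.≟ u | w Fin.≟ v
  ... | yes w≡u | _       = adjacent⇒≡ℓ simple (adjacent-sym simple (binder-adjacent (inj₁ w≡u)))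
  ... | no _    | yes w≡v = adjacent⇒≡ℓ simple (adjacent-sym simple (binder-adjacent (inj₂ w≡v)))
  ... | no w≢u  | no w≢v  =
    ¬adjacent⇒≡0 simple (λ w~p → [ w≢u , w≢v ] (adjacent-binder⇒oneOf (adjacent-sym simple w~p)))

  B-binder-binder : ∀ {u v u≢v u′ v′ u′≢v′} → B (binder u v u≢v) (binder u′ v′ u′≢v′) ≡ 0
  B-binder-binder = ¬adjacent⇒≡0 simple (λ p~p′ → ℕ.<⇒≱ (adjacent-binder⇒<n p~p′) n≤binder)

  threeNeighbours-basic : 2 < n → Connected A → ∀ u → ThreeNeighbours B (basic u)
  threeNeighbours-basic 2<n connected u with twoOthers 2<n u
  ... | v , w , u≢v , u≢w , v≢w with reachable⇒neighbour u≢w (connected u w)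
  ...   | x , u~x = record
    { j₁ = binder u v u≢v ; j₂ = binder u w u≢w ; j₃ = basic x
    ; j₁≢j₂ = [ v≢w ∘ proj₂ , u≢w ∘ proj₁ ] ∘ binder-injective
    ; j₁≢j₃ = basic≢binder ∘ sym
    ; j₂≢j₃ = basic≢binder ∘ sym
    ; adjacent₁ = adjacent-sym simple (binder-adjacent (inj₁ refl))
    ; adjacent₂ = adjacent-sym simple (binder-adjacent (inj₁ refl))
    ; adjacent₃ = adjacent-basic u~x
    }

  data Kind (q : Fin (n₁ n)) : Set where
    basicᵏ  : ∀ (u : Fin n) → q ≡ basic u → Kind q
    binderᵏ : ∀ u v (u≢v : u ≢ v) → q ≡ binder u v u≢v → Kind q

  private
    vertexOf : Fin n → Fin n → Fin (n₁ n)
    vertexOf a b with a Fin.≟ b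
    ... | yes _   = basic a
    ... | no a≢b  = binder a b a≢b

    kind-vertexOf : ∀ a b → Kind (vertexOf a b)
    kind-vertexOf a b with a Fin.≟ b
    ... | yes _   = basicᵏ a refl
    ... | no a≢b  = binderᵏ a b a≢b refl

    vertexOf-injective : ∀ {a b a′ b′} → toℕ a ≤ toℕ b → toℕ a′ ≤ toℕ b′ →
                         vertexOf a b ≡ vertexOf a′ b′ → (a , b) ≡ (a′ , b′)
    vertexOf-injective {a} {b} {a′} {b′} a≤b a′≤b′ e with a Fin.≟ b | a′ Fin.≟ b′
    ... | yes refl | yes refl = cong (λ x → x , x) (basic-injective e)
    ... | yes _    | no _     = ⊥-elim (basic≢binder e)
    ... | no _     | yes _    = ⊥-elim (basic≢binder (sym e))
    ... | no a≢b   | no _     with binder-injective e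
    ...   | inj₁ (refl , refl) = refl
    ...   | inj₂ (refl , refl) = ⊥-elim (a≢b (Fin.toℕ-injective (ℕ.≤-antisym a≤b a′≤b′)))

    pairAt : Fin (n₁ n) → Fin n × Fin n
    pairAt x = pairOf n (cast (n₁≡triangle n) x)

    vertexAt : Fin (n₁ n) → Fin (n₁ n)
    vertexAt x = vertexOf (proj₁ (pairAt x)) (proj₂ (pairAt x))

    vertexAt-injective : Injective _≡_ _≡_ vertexAt
    vertexAt-injective {x} {y} e = Fin.toℕ-injective (begin
      toℕ x                        ≡⟨ Fin.toℕ-cast (n₁≡triangle n) x ⟨
      toℕ (cast (n₁≡triangle n) x) ≡⟨ cong toℕ (pairOf-injective n pairAt-x≡pairAt-y) ⟩
      toℕ (cast (n₁≡triangle n) y) ≡⟨ Fin.toℕ-cast (n₁≡triangle n) y ⟩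
      toℕ y                        ∎)
      where
      open ≡-Reasoning
      pairAt-x≡pairAt-y : pairAt x ≡ pairAt y
      pairAt-x≡pairAt-y = vertexOf-injective (pairOf-≤ n _) (pairOf-≤ n _) e

  kind : ∀ q → Kind q
  kind q with injective⇒surjective vertexAt-injective q
  ... | x , refl = kind-vertexOf (proj₁ (pairAt x)) (proj₂ (pairAt x))

  vertex-ind : (P : Fin (n₁ n) → Set) → (∀ u → P (basic u)) → (∀ u v u≢v → P (binder u v u≢v)) → ∀ q → P q
  vertex-ind P onBasic onBinder q with kind q
  ... | basicᵏ u refl        = onBasic u
  ... | binderᵏ u v u≢v refl = onBinder u v u≢v

  byKind : ∀ {X : Set} → (Fin n → X) → ((u v : Fin n) → u ≢ v → X) → Fin (n₁ n) → X
  byKind onBasic onBinder q with kind q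
  ... | basicᵏ u _        = onBasic u
  ... | binderᵏ u v u≢v _ = onBinder u v u≢v

  module _ {X : Set} {onBasic : Fin n → X} {onBinder : (u v : Fin n) → u ≢ v → X} where

    byKind-basic : ∀ u → byKind onBasic onBinder (basic u) ≡ onBasic u
    byKind-basic u with kind (basic u)
    ... | basicᵏ u′ e       = cong onBasic (basic-injective (sym e))
    ... | binderᵏ _ _ _ e  = ⊥-elim (basic≢binder e)

    byKind-binder : (∀ {u v u′ v′ u≢v u′≢v′} → SamePair u v u′ v′ → onBinder u v u≢v ≡ onBinder u′ v′ u′≢v′) →
                    ∀ u v u≢v → byKind onBasic onBinder (binder u v u≢v) ≡ onBinder u v u≢v
    byKind-binder respects u v u≢v with kind (binder u v u≢v)
    ... | basicᵏ _ e          = ⊥-elim (basic≢binder (sym e))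
    ... | binderᵏ u′ v′ _ e   = respects (binder-injective (sym e))

open BindingGraph using (basicᵏ; binderᵏ)

module _ {n ℓ} {A₁ A₂ : Graph n} {B₁ B₂ : Graph (n₁ n)}
         (bind₁ : IsBindingGraph ℓ A₁ B₁) (bind₂ : IsBindingGraph ℓ A₂ B₂) where

  private
    module G₁ = BindingGraph {A = A₁} {B₁} bind₁
    module G₂ = BindingGraph {A = A₂} {B₂} bind₂

  isIso-basic : 2 < n → Connected A₂ → ∀ {τ} → IsIso B₁ B₂ τ → ∀ u → ∃ λ x → τ ⟨$⟩ʳ basic u ≡ basic x
  isIso-basic 2<n connected₂ {τ} iso u with G₁.kind (τ ⟨$⟩ʳ basic u)
  ... | basicᵏ x τu≡x            = x , τu≡x
  ... | binderᵏ _ _ _ τu≡binder =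
    ⊥-elim (G₁.¬threeNeighbours-binder
             (subst (ThreeNeighbours B₁) τu≡binder
                    (threeNeighbours-iso {G = B₁} {B₂} {τ} iso (G₂.threeNeighbours-basic 2<n connected₂ u))))

module Extension {n ℓ} {A₁ A₂ : Graph n} {B₁ B₂ : Graph (n₁ n)}
                 (bind₁ : IsBindingGraph ℓ A₁ B₁) (bind₂ : IsBindingGraph ℓ A₂ B₂) where

  private
    module G₁ = BindingGraph {A = A₁} {B₁} bind₁
    module G₂ = BindingGraph {A = A₂} {B₂} bind₂

  extendᶠ : Permutation′ n → Fin (n₁ n) → Fin (n₁ n)
  extendᶠ π = G₂.byKind (λ u → basic (π ⟨$⟩ʳ u))
                        (λ u v u≢v → G₁.binder (π ⟨$⟩ʳ u) (π ⟨$⟩ʳ v) (u≢v ∘ ⟨$⟩ʳ-injective π))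

  module _ (π : Permutation′ n) where

    extendᶠ-basic : ∀ u → extendᶠ π (basic u) ≡ basic (π ⟨$⟩ʳ u)
    extendᶠ-basic = G₂.byKind-basic

    extendᶠ-binder : ∀ u v u≢v →
                     extendᶠ π (G₂.binder u v u≢v) ≡ G₁.binder (π ⟨$⟩ʳ u) (π ⟨$⟩ʳ v) (u≢v ∘ ⟨$⟩ʳ-injective π)
    extendᶠ-binder = G₂.byKind-binder (G₁.binder-cong ∘ samePair-map (π ⟨$⟩ʳ_))

    extendᶠ-basic-binder : ∀ w u v u≢v →
      B₁ (extendᶠ π (basic w)) (extendᶠ π (G₂.binder u v u≢v)) ≡ B₂ (basic w) (G₂.binder u v u≢v)
    extendᶠ-basic-binder w u v u≢v = begin
      B₁ (extendᶠ π (basic w)) (extendᶠ π (G₂.binder u v u≢v))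
        ≡⟨ cong₂ B₁ (extendᶠ-basic w) (extendᶠ-binder u v u≢v) ⟩
      B₁ (basic (π ⟨$⟩ʳ w)) (G₁.binder (π ⟨$⟩ʳ u) (π ⟨$⟩ʳ v) _)
        ≡⟨ G₁.B-basic-binder ⟩
      incidence ℓ (π ⟨$⟩ʳ w) (π ⟨$⟩ʳ u) (π ⟨$⟩ʳ v)
        ≡⟨ incidence-injective (⟨$⟩ʳ-injective π) w u v ⟩
      incidence ℓ w u v
        ≡⟨ G₂.B-basic-binder ⟨
      B₂ (basic w) (G₂.binder u v u≢v)
        ∎
      where open ≡-Reasoning

    extendᶠ-iso : IsIso A₁ A₂ π → ∀ i j → B₁ (extendᶠ π i) (extendᶠ π j) ≡ B₂ i j
    extendᶠ-iso iso = G₂.vertex-ind (λ i → ∀ j → B₁ (extendᶠ π i) (extendᶠ π j) ≡ B₂ i j)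
      (λ w → G₂.vertex-ind _ (basic-basic w) (extendᶠ-basic-binder w))
      (λ u v u≢v → G₂.vertex-ind _
        (λ w → trans (proj₁ G₁.simple _ _) (trans (extendᶠ-basic-binder w u v u≢v) (proj₁ G₂.simple _ _)))
        (λ u′ v′ u′≢v′ → trans (cong₂ B₁ (extendᶠ-binder u v u≢v) (extendᶠ-binder u′ v′ u′≢v′))
                               (trans G₁.B-binder-binder (sym G₂.B-binder-binder))))
      where
      basic-basic : ∀ u v → B₁ (extendᶠ π (basic u)) (extendᶠ π (basic v)) ≡ B₂ (basic u) (basic v)
      basic-basic u v = begin
        B₁ (extendᶠ π (basic u)) (extendᶠ π (basic v)) ≡⟨ cong₂ B₁ (extendᶠ-basic u) (extendᶠ-basic v) ⟩
        B₁ (basic (π ⟨$⟩ʳ u)) (basic (π ⟨$⟩ʳ v))       ≡⟨ G₁.B-basic _ _ ⟩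
        A₁ (π ⟨$⟩ʳ u) (π ⟨$⟩ʳ v)                       ≡⟨ iso u v ⟩
        A₂ u v                                         ≡⟨ G₂.B-basic u v ⟨
        B₂ (basic u) (basic v)                         ∎
        where open ≡-Reasoning

  extendᶠ-cong : ∀ {π ρ} → (∀ u → π ⟨$⟩ʳ u ≡ ρ ⟨$⟩ʳ u) → ∀ q → extendᶠ π q ≡ extendᶠ ρ q
  extendᶠ-cong {π} {ρ} π≈ρ = G₂.vertex-ind (λ q → extendᶠ π q ≡ extendᶠ ρ q)
    (λ u → trans (extendᶠ-basic π u) (trans (cong basic (π≈ρ u)) (sym (extendᶠ-basic ρ u))))
    (λ u v u≢v → trans (extendᶠ-binder π u v u≢v)
                   (trans (G₁.binder-cong (inj₁ (π≈ρ u , π≈ρ v))) (sym (extendᶠ-binder ρ u v u≢v))))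

module _ {n ℓ} {A₁ A₂ : Graph n} {B₁ B₂ : Graph (n₁ n)}
         (bind₁ : IsBindingGraph ℓ A₁ B₁) (bind₂ : IsBindingGraph ℓ A₂ B₂) where

  private
    module E₁₂ = Extension {A₁ = A₁} {A₂} {B₁} {B₂} bind₁ bind₂
    module E₂₁ = Extension {A₁ = A₂} {A₁} {B₂} {B₁} bind₂ bind₁
    module G₂ = BindingGraph {A = A₂} {B₂} bind₂

  extendᶠ-inverse : ∀ {π ρ} → (∀ u → ρ ⟨$⟩ʳ (π ⟨$⟩ʳ u) ≡ u) → ∀ q → E₂₁.extendᶠ ρ (E₁₂.extendᶠ π q) ≡ q
  extendᶠ-inverse {π} {ρ} ρπ≡id = G₂.vertex-ind (λ q → E₂₁.extendᶠ ρ (E₁₂.extendᶠ π q) ≡ q)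
    (λ u → trans (cong (E₂₁.extendᶠ ρ) (E₁₂.extendᶠ-basic π u))
                 (trans (E₂₁.extendᶠ-basic ρ _) (cong basic (ρπ≡id u))))
    (λ u v u≢v → trans (cong (E₂₁.extendᶠ ρ) (E₁₂.extendᶠ-binder π u v u≢v))
                       (trans (E₂₁.extendᶠ-binder ρ _ _ _) (G₂.binder-cong (inj₁ (ρπ≡id u , ρπ≡id v)))))

extend : ∀ {n ℓ} {A₁ A₂ : Graph n} {B₁ B₂ : Graph (n₁ n)} →
         IsBindingGraph ℓ A₁ B₁ → IsBindingGraph ℓ A₂ B₂ → Permutation′ n → Permutation′ (n₁ n)
extend {A₁ = A₁} {A₂} {B₁} {B₂} bind₁ bind₂ π =
  permutation (E₁₂.extendᶠ π) (E₂₁.extendᶠ (flip π))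
              (extendᶠ-inverse {A₁ = A₂} {A₁} {B₂} {B₁} bind₂ bind₁ {flip π} {π} (λ _ → inverseʳ π))
              (extendᶠ-inverse {A₁ = A₁} {A₂} {B₁} {B₂} bind₁ bind₂ {π} {flip π} (λ _ → inverseˡ π))
  where
  module E₁₂ = Extension {A₁ = A₁} {A₂} {B₁} {B₂} bind₁ bind₂
  module E₂₁ = Extension {A₁ = A₂} {A₁} {B₂} {B₁} bind₂ bind₁

module Restriction {n ℓ} {A₁ A₂ : Graph n} {B₁ B₂ : Graph (n₁ n)}
                   (bind₁ : IsBindingGraph ℓ A₁ B₁) (bind₂ : IsBindingGraph ℓ A₂ B₂)
                   (2<n : 2 < n) (connected₁ : Connected A₁) (connected₂ : Connected A₂)
                   {τ : Permutation′ (n₁ n)} (iso : IsIso B₁ B₂ τ) where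

  private
    module G₁ = BindingGraph {A = A₁} {B₁} bind₁
    module G₂ = BindingGraph {A = A₂} {B₂} bind₂
    open Extension {A₁ = A₁} {A₂} {B₁} {B₂} bind₁ bind₂

    τ-basic : ∀ u → ∃ λ x → τ ⟨$⟩ʳ basic u ≡ basic x
    τ-basic = isIso-basic {ℓ = ℓ} {A₁ = A₁} {A₂} {B₁} {B₂} bind₁ bind₂ 2<n connected₂ {τ} iso

    τ⁻¹-basic : ∀ u → ∃ λ x → τ ⟨$⟩ˡ basic u ≡ basic x
    τ⁻¹-basic = isIso-basic {ℓ = ℓ} {A₁ = A₂} {A₁} {B₂} {B₁} bind₂ bind₁ 2<n connected₁ {flip τ}
                            (isIso-flip {G = B₁} {B₂} {τ} iso)

  restrict : Permutation′ n
  restrict = restrictₚ basic-injective τ τ-basic τ⁻¹-basic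

  basic-restrict : ∀ u → basic (restrict ⟨$⟩ʳ u) ≡ τ ⟨$⟩ʳ basic u
  basic-restrict u = sym (proj₂ (τ-basic u))

  restrict-iso : IsIso A₁ A₂ restrict
  restrict-iso u v = begin
    A₁ (restrict ⟨$⟩ʳ u) (restrict ⟨$⟩ʳ v)                   ≡⟨ G₁.B-basic _ _ ⟨
    B₁ (basic (restrict ⟨$⟩ʳ u)) (basic (restrict ⟨$⟩ʳ v))   ≡⟨ cong₂ B₁ (basic-restrict u) (basic-restrict v) ⟩
    B₁ (τ ⟨$⟩ʳ basic u) (τ ⟨$⟩ʳ basic v)                     ≡⟨ iso (basic u) (basic v) ⟩
    B₂ (basic u) (basic v)                                   ≡⟨ G₂.B-basic u v ⟩
    A₂ u v                                                   ∎
    where open ≡-Reasoning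

  -- τ p is not basic, since τ⁻¹ preserves basic vertices; so it is the binding
  -- vertex whose two neighbours are the images of those of p.
  binder-restrict : ∀ u v u≢v → τ ⟨$⟩ʳ G₂.binder u v u≢v
                                ≡ G₁.binder (restrict ⟨$⟩ʳ u) (restrict ⟨$⟩ʳ v) (u≢v ∘ ⟨$⟩ʳ-injective restrict)
  binder-restrict u v u≢v with G₁.kind (τ ⟨$⟩ʳ G₂.binder u v u≢v)
  ... | basicᵏ x τp≡x =
    ⊥-elim (G₂.basic≢binder {w = proj₁ (τ⁻¹-basic x)} (trans (sym (proj₂ (τ⁻¹-basic x))) τ⁻¹x≡p))
    where
    τ⁻¹x≡p : τ ⟨$⟩ˡ basic x ≡ G₂.binder u v u≢v
    τ⁻¹x≡p = trans (cong (τ ⟨$⟩ˡ_) (sym τp≡x)) (inverseˡ τ)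
  ... | binderᵏ a b _ τp≡ab =
    trans τp≡ab (sym (G₁.binder-cong (oneOf⇒samePair (ends u (inj₁ refl)) (ends v (inj₂ refl))
                                                     (u≢v ∘ ⟨$⟩ʳ-injective restrict))))
    where
    ends : ∀ w → OneOf w u v → OneOf (restrict ⟨$⟩ʳ w) a b
    ends w w∈uv = G₁.adjacent-binder⇒oneOf
      (subst₂ (Adjacent B₁) τp≡ab (sym (basic-restrict w))
              (adjacent-iso {G = B₁} {B₂} {τ} iso (G₂.binder-adjacent w∈uv)))

  extendᶠ-restrict : ∀ q → extendᶠ restrict q ≡ τ ⟨$⟩ʳ q
  extendᶠ-restrict = G₂.vertex-ind (λ q → extendᶠ restrict q ≡ τ ⟨$⟩ʳ q)
    (λ u → trans (extendᶠ-basic restrict u) (basic-restrict u))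
    (λ u v u≢v → trans (extendᶠ-binder restrict u v u≢v) (sym (binder-restrict u v u≢v)))

≅⇔≅ : ∀ {n ℓ} {A₁ A₂ : Graph n} {B₁ B₂ : Graph (n₁ n)} → 2 < n → Connected A₁ → Connected A₂ →
      IsBindingGraph ℓ A₁ B₁ → IsBindingGraph ℓ A₂ B₂ → (A₁ ≅ A₂) ⇔ (B₁ ≅ B₂)
≅⇔≅ {n} {A₁ = A₁} {A₂} {B₁} {B₂} 2<n connected₁ connected₂ bind₁ bind₂ = mk⇔
  (λ { (π , iso) → extend {A₁ = A₁} {A₂} {B₁} {B₂} bind₁ bind₂ π , E.extendᶠ-iso π iso })
  (λ { (τ , iso) → R.restrict τ iso , R.restrict-iso τ iso })
  where
  module E = Extension {A₁ = A₁} {A₂} {B₁} {B₂} bind₁ bind₂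
  module R (τ : Permutation′ (n₁ n)) (iso : IsIso B₁ B₂ τ) =
    Restriction {A₁ = A₁} {A₂} {B₁} {B₂} bind₁ bind₂ 2<n connected₁ connected₂ {τ} iso

module Automorphisms {n ℓ} {A : Graph n} {B : Graph (n₁ n)} (bind : IsBindingGraph ℓ A B)
                     (2<n : 2 < n) (connected : Connected A) where

  private
    module G = BindingGraph {A = A} {B} bind
    open Extension {A₁ = A} {A} {B} {B} bind bind
    module R (τ : Permutation′ (n₁ n)) (aut : IsAut B τ) =
      Restriction {A₁ = A} {A} {B} {B} bind bind 2<n connected connected {τ} aut

    extendᴮ : Permutation′ n → Permutation′ (n₁ n)
    extendᴮ = extend {A₁ = A} {A} {B} {B} bind bind

  extendᶠ-∘ₚ : ∀ π ρ q → extendᶠ (π ∘ₚ ρ) q ≡ extendᶠ ρ (extendᶠ π q)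
  extendᶠ-∘ₚ π ρ = G.vertex-ind (λ q → extendᶠ (π ∘ₚ ρ) q ≡ extendᶠ ρ (extendᶠ π q))
    (λ u → trans (extendᶠ-basic (π ∘ₚ ρ) u)
                 (sym (trans (cong (extendᶠ ρ) (extendᶠ-basic π u)) (extendᶠ-basic ρ _))))
    (λ u v u≢v → trans (extendᶠ-binder (π ∘ₚ ρ) u v u≢v)
                       (sym (trans (cong (extendᶠ ρ) (extendᶠ-binder π u v u≢v))
                                   (trans (extendᶠ-binder ρ _ _ _) (G.binder-cong (inj₁ (refl , refl)))))))

  autIso : AutIso A B
  autIso = record
    { to        = λ { (π , aut) → extendᴮ π , extendᶠ-iso π aut }
    ; from      = λ { (τ , aut) → R.restrict τ aut , R.restrict-iso τ aut }
    ; to-cong   = λ { {π , _} {ρ , _} → extendᶠ-cong {π} {ρ} }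
    ; from-cong = λ { {σ , aut₁} {τ , aut₂} σ≈τ u →
        basic-injective (trans (R.basic-restrict σ aut₁ u)
                               (trans (σ≈τ (basic u)) (sym (R.basic-restrict τ aut₂ u)))) }
    ; to-hom    = λ { (π , _) (ρ , _) → extendᶠ-∘ₚ π ρ }
    ; from∘to   = λ { (π , aut) u →
        basic-injective (trans (R.basic-restrict (extendᴮ π) (extendᶠ-iso π aut) u) (extendᶠ-basic π u)) }
    ; to∘from   = λ { (τ , aut) → R.extendᶠ-restrict τ aut }
    }

  basic-¬sameOrbit-binding : ∀ u p → toℕ u < n → n ≤ toℕ p → ¬ SameOrbit B u p
  basic-¬sameOrbit-binding u p u<n n≤p (σ , aut , σu≡p) =
    ℕ.<⇒≱ σu<n (subst (λ q → n ≤ toℕ q) (sym σu≡p) n≤p)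
    where
    σu<n : toℕ (σ ⟨$⟩ʳ u) < n
    σu<n = subst (λ q → toℕ (σ ⟨$⟩ʳ q) < n) (basic-fromℕ< u<n)
                 (subst (λ q → toℕ q < n) (R.basic-restrict σ aut (fromℕ< u<n)) (basic<n _))

  sameOrbit-basic⇔ : ∀ u v (u<n : toℕ u < n) (v<n : toℕ v < n) →
                     SameOrbit B u v ⇔ SameOrbit A (fromℕ< u<n) (fromℕ< v<n)
  sameOrbit-basic⇔ u v u<n v<n = mk⇔
    (λ { (σ , aut , σu≡v) → R.restrict σ aut , R.restrict-iso σ aut , basic-injective (begin
      basic (R.restrict σ aut ⟨$⟩ʳ fromℕ< u<n) ≡⟨ R.basic-restrict σ aut _ ⟩
      σ ⟨$⟩ʳ basic (fromℕ< u<n)             ≡⟨ cong (σ ⟨$⟩ʳ_) (basic-fromℕ< u<n) ⟩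
      σ ⟨$⟩ʳ u                              ≡⟨ σu≡v ⟩
      v                                    ≡⟨ basic-fromℕ< v<n ⟨
      basic (fromℕ< v<n)                   ∎) })
    (λ { (π , aut , πu≡v) → extendᴮ π , extendᶠ-iso π aut , (begin
      extendᶠ π u                          ≡⟨ cong (extendᶠ π) (basic-fromℕ< u<n) ⟨
      extendᶠ π (basic (fromℕ< u<n))       ≡⟨ extendᶠ-basic π _ ⟩
      basic (π ⟨$⟩ʳ fromℕ< u<n)             ≡⟨ cong basic πu≡v ⟩
      basic (fromℕ< v<n)                   ≡⟨ basic-fromℕ< v<n ⟩
      v                                    ∎) })
    where open ≡-Reasoning

theorem7 : ∀ (n ℓ : ℕ) → 2 < n →
    (A₁ A₂ : Graph n) (B₁ B₂ : Graph (n₁ n)) →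
    SimpleWith ℓ A₁ → SimpleWith ℓ A₂ →
    Connected A₁ → Connected A₂ →
    IsBindingGraph ℓ A₁ B₁ → IsBindingGraph ℓ A₂ B₂ →
    ((A₁ ≅ A₂) ⇔ (B₁ ≅ B₂))
    × AutIso A₁ B₁
    × (∀ (u p : Fin (n₁ n)) → toℕ u < n → n ≤ toℕ p → ¬ SameOrbit B₁ u p)
    × (∀ (u v : Fin (n₁ n)) (hu : toℕ u < n) (hv : toℕ v < n) →
         SameOrbit B₁ u v ⇔ SameOrbit A₁ (fromℕ< hu) (fromℕ< hv))
theorem7 n ℓ 2<n A₁ A₂ B₁ B₂ _ _ connected₁ connected₂ bind₁ bind₂ =
  ≅⇔≅ {A₁ = A₁} {A₂} {B₁} {B₂} 2<n connected₁ connected₂ bind₁ bind₂ ,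
  autIso ,
  basic-¬sameOrbit-binding ,
  sameOrbit-basic⇔
  where open Automorphisms {A = A₁} {B₁} bind₁ 2<n connected₁
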